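{- Let $\sigma$ be a local solution of the flat disunification problem $\Gamma$. Then there is a satisfying valuation $\tau$ of $\mathsf{Cl}(\Gamma)$ such that $\sigma_{S^\tau}$ is equivalent to $\sigma$, i.e.\ $\sigma_{S^\tau}(X)\equiv\sigma(X)$ for all variables $X$.
   Context: $\mathcal{EL}$ concept terms are built from concept names and role names using $C\sqcap D$, $\exists r.C$ and $\top$; $C\sqsubseteq D$ means $C^{\mathcal I}\subseteq D^{\mathcal I}$ in every interpretation, and $C\equiv D$ means mutual subsumption. Concept names are split into variables $N_v$ and constants $N_c$. $\Gamma$ is a flat disunification problem: subsumptions $C_1\sqcap\dots\sqcap C_n\sqsubseteq^? D$ of flat atoms (concept names or $\exists r.A$, $A$ a concept name) and dissubsumptions, all of the form $X\not\sqsubseteq^? Y$ with variables $X,Y$; $N_v,N_c,N_R$ are exactly the variables, constants and roles occurring in $\Gamma$. $\mathsf{At}$ = atoms occurring as subterms of $\Gamma$, $\mathsf{At_{nv}}=\mathsf{At}\setminus N_v$. A local solution is a solution of the form $\sigma_S$ where $S$ assigns each variable $X$ a set $S_X\subseteq\mathsf{At_{nv}}$, the transitive closure of "$Y$ occurs in an atom of $S_X$" is irreflexive, and $\sigma_S(X):=\sigma_S(D_1)\sqcap\dots\sqcap\sigma_S(D_k)$ for $S_X=\{D_1,\dots,D_k\}$ ($\top$ if empty). $\mathsf{Cl}(\Gamma)$ is the clause set over propositional variables $[C\sqsubseteq D]$ ($C,D\in\mathsf{At}$), $[X>Y]$ ($X,Y\in N_v$), $p_{C,X,D}$ ($C\in\mathsf{At}$,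 $X\in N_v$, $D\in\mathsf{At_{nv}}$): (Ia) for each $C_1\sqcap\dots\sqcap C_n\sqsubseteq^? D$ in $\Gamma$ with $D\in\mathsf{At_{nv}}$: $[C_1\sqsubseteq D]\lor\dots\lor[C_n\sqsubseteq D]$; (Ib) for each $C_1\sqcap\dots\sqcap C_n\sqsubseteq^? X$ in $\Gamma$, $X\in N_v$, and $E\in\mathsf{At_{nv}}$: $[X\sqsubseteq E]\to[C_1\sqsubseteq E]\lor\dots\lor[C_n\sqsubseteq E]$; (Ic) for each $X\not\sqsubseteq^? Y$ in $\Gamma$: $\lnot[X\sqsubseteq Y]$; (IIa) $[A\sqsubseteq A]$ for $A\in N_c$; (IIb) $\lnot[A\sqsubseteq B]$ for distinct $A,B\in N_c$; (IIc) $\lnot[\exists r.A\sqsubseteq\exists s.B]$ for $\exists r.A,\exists s.B\in\mathsf{At_{nv}}$, $r\ne s$; (IId) $\lnot[A\sqsubseteq\exists r.B]$ and $\lnot[\exists r.B\sqsubseteq A]$ for $A\in N_c$, $\exists r.B\in\mathsf{At_{nv}}$; (IIe) $[\exists r.A\sqsubseteq\exists r.B]\to[A\sqsubseteq B]$ and $[A\sqsubseteq B]\to[\exists r.A\sqsubseteq\exists r.B]$; (III) $[C_1\sqsubseteq C_2]\land[C_2\sqsubseteq C_3]\to[C_1\sqsubseteq C_3]$ for $C_1,C_2,C_3\in\mathsf{At}$; (IV) for $C\in\mathsf{At}$, $X\in N_v$: $[C\sqsubseteq X]\lor\bigvee_{D\in\mathsf{At_{nv}}}p_{C,X,D}$,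 and for each $D\in\mathsf{At_{nv}}$: $p_{C,X,D}\to[X\sqsubseteq D]$ and $\lnot(p_{C,X,D}\land[C\sqsubseteq D])$; (Va) $\lnot[X>X]$; (Vb) $[X>Y]\land[Y>Z]\to[X>Z]$; (Vc) $[X\sqsubseteq\exists r.Y]\to[X>Y]$ for $X,Y\in N_v$ with $\exists r.Y\in\mathsf{At}$. For a satisfying valuation $\tau$, $S^\tau_X:=\{D\in\mathsf{At_{nv}}\mid\tau([X\sqsubseteq D])=1\}$; $S^\tau$ is acyclic and $\sigma_{S^\tau}(X):=\sigma_{S^\tau}(D_1)\sqcap\dots\sqcap\sigma_{S^\tau}(D_k)$ for $S^\tau_X=\{D_1,\dots,D_k\}$. -}

module Defs where

open import Data.Nat using (ℕ)
open import Data.Bool using (Bool; true; false)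
open import Data.Unit using (⊤)
open import Data.Empty using (⊥)
open import Data.Product using (Σ; ∃; _×_; _,_)
open import Data.Sum using (_⊎_)
open import Data.List using (List; []; _∷_; _++_; concatMap; map; filter)
open import Data.List.Relation.Unary.Any using (Any)
open import Data.List.Membership.Propositional using (_∈_)
open import Relation.Nullary using (¬_)
open import Relation.Binary.PropositionalEquality using (_≡_; _≢_)
open import Relation.Binary.Construct.Closure.Transitive using (TransClosure)
open import Data.Bool using (_≟_)

data CName : Set where
  var : ℕ → CName
  con : ℕ → CName

Role : Set
Role = ℕ

data Concept : Set where
  cname : CName → Concept
  ⊤c    : Concept
  _⊓_   : Concept → Concept → Concept
  ∃∙    : Role → Concept → Concept

⨅ : List Concept → Concept
⨅ []           = ⊤c
⨅ (c ∷ [])     = c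
⨅ (c ∷ d ∷ cs) = c ⊓ ⨅ (d ∷ cs)

record Interp : Set₁ where
  field
    Δ     : Set
    elem  : Δ
    conc  : CName → Δ → Set
    role  : Role → Δ → Δ → Set

⟦_⟧ : Concept → (I : Interp) → Interp.Δ I → Set
⟦ cname A ⟧ I d = Interp.conc I A d
⟦ ⊤c ⟧      I d = ⊤
⟦ C ⊓ D ⟧   I d = ⟦ C ⟧ I d × ⟦ D ⟧ I d
⟦ ∃∙ r C ⟧  I d = Σ (Interp.Δ I) (λ e → Interp.role I r d e × ⟦ C ⟧ I e)

_⊑_ : Concept → Concept → Set₁
C ⊑ D = ∀ (I : Interp) (d : Interp.Δ I) → ⟦ C ⟧ I d → ⟦ D ⟧ I d

_≣_ : Concept → Concept → Set₁
C ≣ D = (C ⊑ D) × (D ⊑ C)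

data Atom : Set where
  aname : CName → Atom
  aex   : Role → CName → Atom

NonVar : Atom → Set
NonVar (aname (var _)) = ⊥
NonVar (aname (con _)) = ⊤
NonVar (aex _ _)       = ⊤

record FlatSub : Set where
  constructor _⊑?_
  field
    lhs : List Atom
    rhs : Atom

-- flat dissubsumption  X ⋢? Y  between variables (given by their indices)
record FlatDis : Set where
  constructor _⋢?_
  field
    dl : ℕ
    dr : ℕ

record Problem : Set where
  field
    subs : List FlatSub
    diss : List FlatDis

open Problem public
open FlatSub public
open FlatDis public

subAtoms : Atom → List Atom
subAtoms (aname A) = aname A ∷ []
subAtoms (aex r A) = aex r A ∷ aname A ∷ []

At : Problem → List Atom
At Γ = concatMap (λ s → concatMap subAtoms (lhs s ++ (rhs s ∷ []))) (subs Γ)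
    ++ concatMap (λ d → aname (var (dl d)) ∷ aname (var (dr d)) ∷ []) (diss Γ)

_∈At_ : Atom → Problem → Set
D ∈At Γ = D ∈ At Γ

_∈Atnv_ : Atom → Problem → Set
D ∈Atnv Γ = (D ∈ At Γ) × NonVar D

_∈Nv_ : ℕ → Problem → Set
X ∈Nv Γ = aname (var X) ∈ At Γ

_∈Nc_ : ℕ → Problem → Set
A ∈Nc Γ = aname (con A) ∈ At Γ

Subst : Set
Subst = ℕ → Concept

substName : Subst → CName → Concept
substName σ (var X) = σ X
substName σ (con A) = cname (con A)

substAtom : Subst → Atom → Concept
substAtom σ (aname A) = substName σ A
substAtom σ (aex r A) = ∃∙ r (substName σ A)

IsSolution : Problem → Subst → Set₁
IsSolution Γ σ =
    (∀ {s} → s ∈ subs Γ → ⨅ (map (substAtom σ) (lhs s)) ⊑ substAtom σ (rhs s))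
  × (∀ {d} → d ∈ diss Γ → ¬ (σ (dl d) ⊑ σ (dr d)))

Assignment : Set
Assignment = ℕ → List Atom

-- "Y occurs in an atom of S_X" (for X ∈ N_v; atoms of S_X are non-variable,
-- so Y occurs in D ∈ S_X iff D = ∃r.Y)
DependsOn : Problem → Assignment → ℕ → ℕ → Set
DependsOn Γ S X Y = (X ∈Nv Γ) × ∃ (λ r → aex r (var Y) ∈ S X)

IsAssignment : Problem → Assignment → Set
IsAssignment Γ S =
    (∀ {X} → X ∈Nv Γ → ∀ {D} → D ∈ S X → D ∈Atnv Γ)
  × (∀ X → ¬ TransClosure (DependsOn Γ S) X X)

-- σ is σ_S on the variables of Γ: it satisfies the (recursive, well-founded
-- by acyclicity) defining equations σ(X) = σ(D₁) ⊓ … ⊓ σ(D_k), S_X = {D₁,…,D_k}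
IsInduced : Problem → Assignment → Subst → Set
IsInduced Γ S σ = ∀ {X} → X ∈Nv Γ → σ X ≡ ⨅ (map (substAtom σ) (S X))

IsLocalSolution : Problem → Subst → Set₁
IsLocalSolution Γ σ =
  IsSolution Γ σ × Σ Assignment (λ S → IsAssignment Γ S × IsInduced Γ S σ)

data PVar : Set where
  [_⊑ᵖ_] : Atom → Atom → PVar
  [_>ᵖ_] : ℕ → ℕ → PVar
  p      : Atom → ℕ → Atom → PVar

Valuation : Set
Valuation = PVar → Bool

vX : ℕ → Atom
vX X = aname (var X)

record Satisfies (Γ : Problem) (τ : Valuation) : Set where
  field
    Ia  : ∀ {s} → s ∈ subs Γ → NonVar (rhs s) →
          Any (λ C → τ [ C ⊑ᵖ rhs s ] ≡ true) (lhs s)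
    Ib  : ∀ {cs X} → (cs ⊑? vX X) ∈ subs Γ → ∀ {E} → E ∈Atnv Γ →
          τ [ vX X ⊑ᵖ E ] ≡ true → Any (λ C → τ [ C ⊑ᵖ E ] ≡ true) cs
    Ic  : ∀ {d} → d ∈ diss Γ → τ [ vX (dl d) ⊑ᵖ vX (dr d) ] ≡ false
    IIa : ∀ {A} → A ∈Nc Γ → τ [ aname (con A) ⊑ᵖ aname (con A) ] ≡ true
    IIb : ∀ {A B} → A ∈Nc Γ → B ∈Nc Γ → A ≢ B →
          τ [ aname (con A) ⊑ᵖ aname (con B) ] ≡ false
    IIc : ∀ {r A s B} → aex r A ∈At Γ → aex s B ∈At Γ → r ≢ s →
          τ [ aex r A ⊑ᵖ aex s B ] ≡ false
    IId₁ : ∀ {A r B} → A ∈Nc Γ → aex r B ∈At Γ →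
          τ [ aname (con A) ⊑ᵖ aex r B ] ≡ false
    IId₂ : ∀ {A r B} → A ∈Nc Γ → aex r B ∈At Γ →
          τ [ aex r B ⊑ᵖ aname (con A) ] ≡ false
    IIe₁ : ∀ {r A B} → aex r A ∈At Γ → aex r B ∈At Γ →
          τ [ aex r A ⊑ᵖ aex r B ] ≡ true → τ [ aname A ⊑ᵖ aname B ] ≡ true
    IIe₂ : ∀ {r A B} → aex r A ∈At Γ → aex r B ∈At Γ →
          τ [ aname A ⊑ᵖ aname B ] ≡ true → τ [ aex r A ⊑ᵖ aex r B ] ≡ true
    III : ∀ {C₁ C₂ C₃} → C₁ ∈At Γ → C₂ ∈At Γ → C₃ ∈At Γ →
          τ [ C₁ ⊑ᵖ C₂ ] ≡ true → τ [ C₂ ⊑ᵖ C₃ ] ≡ true → τ [ C₁ ⊑ᵖ C₃ ] ≡ true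
    IV₁ : ∀ {C X} → C ∈At Γ → X ∈Nv Γ →
          (τ [ C ⊑ᵖ vX X ] ≡ true) ⊎ Σ Atom (λ D → D ∈Atnv Γ × τ (p C X D) ≡ true)
    IV₂ : ∀ {C X D} → C ∈At Γ → X ∈Nv Γ → D ∈Atnv Γ →
          τ (p C X D) ≡ true → τ [ vX X ⊑ᵖ D ] ≡ true
    IV₃ : ∀ {C X D} → C ∈At Γ → X ∈Nv Γ → D ∈Atnv Γ →
          ¬ (τ (p C X D) ≡ true × τ [ C ⊑ᵖ D ] ≡ true)
    Va  : ∀ {X} → X ∈Nv Γ → τ [ X >ᵖ X ] ≡ false
    Vb  : ∀ {X Y Z} → X ∈Nv Γ → Y ∈Nv Γ → Z ∈Nv Γ →
          τ [ X >ᵖ Y ] ≡ true → τ [ Y >ᵖ Z ] ≡ true → τ [ X >ᵖ Z ] ≡ true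
    Vc  : ∀ {X Y r} → X ∈Nv Γ → Y ∈Nv Γ → aex r (var Y) ∈At Γ →
          τ [ vX X ⊑ᵖ aex r (var Y) ] ≡ true → τ [ X >ᵖ Y ] ≡ true

nonVar? : Atom → Bool
nonVar? (aname (var _)) = false
nonVar? (aname (con _)) = true
nonVar? (aex _ _)       = true

Sτ : Problem → Valuation → Assignment
Sτ Γ τ X = filter (λ D → nonVar? D ≟ true) (filter (λ D → τ [ vX X ⊑ᵖ D ] ≟ true) (At Γ))

-- Subsumption of EL concepts is structural: C ⊑ D holds iff D is true at C in
-- the canonical model whose elements are concepts, C having the concept names
-- and the r-successors E (for each ∃r.E) occurring at its top level. Hence ⊑
-- is decidable, role depth is monotone along ⊑, and concept names and
-- existential restrictions are prime: C₁ ⊓ … ⊓ Cₙ ⊑ A forces some Cᵢ ⊑ A.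
--
-- The valuation makes [C ⊑ D] true iff σ(C) ⊑ σ(D), [X > Y] true iff σ(Y) has
-- smaller role depth than σ(X), and p_{C,X,D} true iff σ(C) ⋢ σ(D) and
-- σ(X) ⊑ σ(D). Primeness yields (Ia) and (Ib), and (IV) holds because
-- σ(X) = σ(S_X) is the conjunction of its atoms. Finally S^τ_X consists of all
-- atoms of At_nv above σ(X), which include S_X, so their conjunction is
-- equivalent to σ(X); the induced substitution is obtained by unfolding S^τ,
-- which terminates since the filler Y of any ∃r.Y ∈ S^τ_X has σ(Y) of smaller
-- role depth than σ(X).

module Submission where

open import Defs
open import Data.Nat using (ℕ; zero; suc; _≤_; _<_; _⊔_; z≤n; s≤s; _<?_)
  renaming (_≟_ to _≟ℕ_)
open import Data.Nat.Properties using (m≤m⊔n; m≤n⊔m; ⊔-lub; <-irrefl; <-trans; ≤-refl; <-≤-trans; ≤-<-trans)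
open import Data.Bool using (true; false) renaming (_≟_ to _≟ᴮ_)
open import Data.Unit using (tt)
open import Data.Empty using (⊥-elim)
open import Data.Product using (Σ; _×_; _,_; proj₁; proj₂)
open import Data.Sum using (_⊎_; inj₁; inj₂; [_,_]′)
open import Data.List using (List; []; _∷_; _++_; map; concatMap)
open import Data.List.Properties using (map-cong-local)
open import Data.List.Relation.Unary.Any using (Any; here; there; any?; satisfied)
import Data.List.Relation.Unary.Any as Any
import Data.List.Relation.Unary.Any.Properties as Any
open import Data.List.Relation.Unary.All using (All)
import Data.List.Relation.Unary.All as All
import Data.List.Relation.Unary.All.Properties as All
open import Data.List.Membership.Propositional using (_∈_; find; lose)
open import Data.List.Membership.Propositional.Properties
  using (∈-++⁺ˡ; ∈-++⁺ʳ; ∈-++⁻; ∈-map⁺; ∈-map⁻; ∈-filter⁺; ∈-filter⁻; ∈-concatMap⁺; ∈-concatMap⁻)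
open import Data.List.Relation.Binary.Subset.Propositional using (_⊆_)
open import Function using (_∘_)
open import Relation.Nullary using (¬_; Dec; yes; no; does; _×-dec_; ¬?)
import Relation.Nullary.Decidable as Dec
open import Relation.Nullary.Decidable using (dec-true; dec-false)
open import Relation.Binary using (DecidableEquality; Decidable)
open import Relation.Binary.PropositionalEquality using (_≡_; refl; sym; cong; subst)

_≟ᴺ_ : DecidableEquality CName
var m ≟ᴺ var n = Dec.map′ (cong var) (λ { refl → refl }) (m ≟ℕ n)
con m ≟ᴺ con n = Dec.map′ (cong con) (λ { refl → refl }) (m ≟ℕ n)
var _ ≟ᴺ con _ = no λ ()
con _ ≟ᴺ var _ = no λ ()

open import Data.List.Membership.DecPropositional _≟ᴺ_ using (_∈?_)

names : Concept → List CName
names (cname A) = A ∷ []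
names ⊤c        = []
names (C ⊓ D)   = names C ++ names D
names (∃∙ _ _)  = []

successors : Concept → List (Role × Concept)
successors (cname _) = []
successors ⊤c        = []
successors (C ⊓ D)   = successors C ++ successors D
successors (∃∙ r C)  = (r , C) ∷ []

canonical : Interp
canonical = record
  { Δ    = Concept
  ; elem = ⊤c
  ; conc = λ A C → A ∈ names C
  ; role = λ r C E → (r , E) ∈ successors C
  }

names-sound : ∀ C {A} → A ∈ names C → C ⊑ cname A
names-sound (cname _) (here refl) I d x = x
names-sound (C₁ ⊓ C₂) m I d (x₁ , x₂) with ∈-++⁻ (names C₁) m
... | inj₁ m₁ = names-sound C₁ m₁ I d x₁
... | inj₂ m₂ = names-sound C₂ m₂ I d x₂

successors-sound : ∀ C {r E} → (r , E) ∈ successors C → C ⊑ ∃∙ r E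
successors-sound (C₁ ⊓ C₂) m I d (x₁ , x₂) with ∈-++⁻ (successors C₁) m
... | inj₁ m₁ = successors-sound C₁ m₁ I d x₁
... | inj₂ m₂ = successors-sound C₂ m₂ I d x₂
successors-sound (∃∙ _ _) (here refl) I d x = x

canonical-sound : ∀ C D → ⟦ D ⟧ canonical C → C ⊑ D
canonical-sound C (cname _) t = names-sound C t
canonical-sound _ ⊤c t I d x = tt
canonical-sound C (D₁ ⊓ D₂) (t₁ , t₂) I d x =
  canonical-sound C D₁ t₁ I d x , canonical-sound C D₂ t₂ I d x
canonical-sound C (∃∙ r D) (E , m , t) I d x with successors-sound C m I d x
... | y , ry , Ey = y , ry , canonical-sound E D t I y Ey

canonical-mono : ∀ {C C′} D → names C ⊆ names C′ → successors C ⊆ successors C′ →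
                 ⟦ D ⟧ canonical C → ⟦ D ⟧ canonical C′
canonical-mono (cname _) ns ss t = ns t
canonical-mono ⊤c ns ss t = tt
canonical-mono (D₁ ⊓ D₂) ns ss (t₁ , t₂) = canonical-mono D₁ ns ss t₁ , canonical-mono D₂ ns ss t₂
canonical-mono (∃∙ _ _) ns ss (E , m , t) = E , ss m , t

canonical-self : ∀ C → ⟦ C ⟧ canonical C
canonical-self (cname _) = here refl
canonical-self ⊤c = tt
canonical-self (C₁ ⊓ C₂) =
  canonical-mono C₁ ∈-++⁺ˡ ∈-++⁺ˡ (canonical-self C₁) ,
  canonical-mono C₂ (∈-++⁺ʳ (names C₁)) (∈-++⁺ʳ (successors C₁)) (canonical-self C₂)
canonical-self (∃∙ _ C) = C , here refl , canonical-self C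

canonical-complete : ∀ C D → C ⊑ D → ⟦ D ⟧ canonical C
canonical-complete C D C⊑D = C⊑D canonical C (canonical-self C)

canonical? : ∀ D C → Dec (⟦ D ⟧ canonical C)
canonical? (cname B) C = B ∈? names C
canonical? ⊤c C = yes tt
canonical? (D₁ ⊓ D₂) C = canonical? D₁ C ×-dec canonical? D₂ C
canonical? (∃∙ r D) C =
  Dec.map′ fromAny (λ (E , m , t) → lose m (refl , t))
           (any? (λ (s , E) → (s ≟ℕ r) ×-dec canonical? D E) (successors C))
  where
  fromAny : Any (λ (s , E) → s ≡ r × ⟦ D ⟧ canonical E) (successors C) → ⟦ ∃∙ r D ⟧ canonical C
  fromAny a with find a
  ... | (_ , E) , m , refl , t = E , m , t

⊑-dec : Decidable _⊑_
⊑-dec C D = Dec.map′ (canonical-sound C D) (canonical-complete C D) (canonical? D C)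

⊑-trans : ∀ C D E → C ⊑ D → D ⊑ E → C ⊑ E
⊑-trans _ _ _ C⊑D D⊑E I d = D⊑E I d ∘ C⊑D I d

∃-mono : ∀ r C D → C ⊑ D → ∃∙ r C ⊑ ∃∙ r D
∃-mono _ _ _ C⊑D I d (e , de , Ce) = e , de , C⊑D I e Ce

∃-⊑-∃⁻ : ∀ r s C D → ∃∙ r C ⊑ ∃∙ s D → r ≡ s × C ⊑ D
∃-⊑-∃⁻ r s C D h with canonical-complete (∃∙ r C) (∃∙ s D) h
... | _ , here refl , t = refl , canonical-sound _ D t

name-⊑-name⁻ : ∀ A B → cname A ⊑ cname B → A ≡ B
name-⊑-name⁻ A B h with canonical-complete (cname A) (cname B) h
... | here refl = refl

name-⋢-∃ : ∀ A r C → ¬ (cname A ⊑ ∃∙ r C)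
name-⋢-∃ A r C h with canonical-complete (cname A) (∃∙ r C) h
... | _ , () , _

∃-⋢-name : ∀ A r C → ¬ (∃∙ r C ⊑ cname A)
∃-⋢-name A r C h with canonical-complete (∃∙ r C) (cname A) h
... | ()

Prime : Concept → Set₁
Prime D = ¬ (⊤c ⊑ D) × (∀ C₁ C₂ → (C₁ ⊓ C₂) ⊑ D → C₁ ⊑ D ⊎ C₂ ⊑ D)

name-prime : ∀ A → Prime (cname A)
name-prime A = (λ h → ⊤⋢A (canonical-complete ⊤c (cname A) h)) , split
  where
  ⊤⋢A : ¬ (A ∈ [])
  ⊤⋢A ()
  split : ∀ C₁ C₂ → (C₁ ⊓ C₂) ⊑ cname A → C₁ ⊑ cname A ⊎ C₂ ⊑ cname A
  split C₁ C₂ h with ∈-++⁻ (names C₁) (canonical-complete (C₁ ⊓ C₂) (cname A) h)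
  ... | inj₁ m = inj₁ (names-sound C₁ m)
  ... | inj₂ m = inj₂ (names-sound C₂ m)

∃-prime : ∀ r D → Prime (∃∙ r D)
∃-prime r D = (λ h → ⊤⋢∃ (canonical-complete ⊤c (∃∙ r D) h)) , split
  where
  ⊤⋢∃ : ¬ ⟦ ∃∙ r D ⟧ canonical ⊤c
  ⊤⋢∃ (_ , () , _)
  split : ∀ C₁ C₂ → (C₁ ⊓ C₂) ⊑ ∃∙ r D → C₁ ⊑ ∃∙ r D ⊎ C₂ ⊑ ∃∙ r D
  split C₁ C₂ h with canonical-complete (C₁ ⊓ C₂) (∃∙ r D) h
  ... | E , m , t with ∈-++⁻ (successors C₁) m
  ...   | inj₁ m₁ = inj₁ (canonical-sound C₁ (∃∙ r D) (E , m₁ , t))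
  ...   | inj₂ m₂ = inj₂ (canonical-sound C₂ (∃∙ r D) (E , m₂ , t))

⨅-prime : ∀ D → Prime D → ∀ cs → ⨅ cs ⊑ D → Any (_⊑ D) cs
⨅-prime _ (⊤⋢D , _) [] h = ⊥-elim (⊤⋢D h)
⨅-prime _ _ (c ∷ []) h = here h
⨅-prime D P (c ∷ cs@(_ ∷ _)) h = [ here , there ∘ ⨅-prime D P cs ]′ (proj₂ P c (⨅ cs) h)

⨅-⊑ : ∀ {c} cs → c ∈ cs → ⨅ cs ⊑ c
⨅-⊑ (_ ∷ []) (here refl) I d x = x
⨅-⊑ (_ ∷ _ ∷ _) (here refl) I d (x , _) = x
⨅-⊑ (_ ∷ c′ ∷ cs) (there m) I d (_ , x) = ⨅-⊑ (c′ ∷ cs) m I d x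

⊑-⨅ : ∀ C cs → All (C ⊑_) cs → C ⊑ ⨅ cs
⊑-⨅ _ [] _ I d x = tt
⊑-⨅ _ (_ ∷ []) (C⊑c All.∷ _) = C⊑c
⊑-⨅ C (_ ∷ cs@(_ ∷ _)) (C⊑c All.∷ hs) I d x = C⊑c I d x , ⊑-⨅ C cs hs I d x

depth : Concept → ℕ
depth (cname _) = 0
depth ⊤c        = 0
depth (C ⊓ D)   = depth C ⊔ depth D
depth (∃∙ _ C)  = suc (depth C)

successor-depth : ∀ {r E} C → (r , E) ∈ successors C → depth E < depth C
successor-depth (C₁ ⊓ C₂) m with ∈-++⁻ (successors C₁) m
... | inj₁ m₁ = <-≤-trans (successor-depth C₁ m₁) (m≤m⊔n (depth C₁) (depth C₂))
... | inj₂ m₂ = <-≤-trans (successor-depth C₂ m₂) (m≤n⊔m (depth C₁) (depth C₂))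
successor-depth (∃∙ _ _) (here refl) = ≤-refl

⊑-depth : ∀ C D → C ⊑ D → depth D ≤ depth C
⊑-depth _ (cname _) _ = z≤n
⊑-depth _ ⊤c _ = z≤n
⊑-depth C (D₁ ⊓ D₂) h =
  ⊔-lub (⊑-depth C D₁ (λ I d → proj₁ ∘ h I d)) (⊑-depth C D₂ (λ I d → proj₂ ∘ h I d))
⊑-depth C (∃∙ r D) h with canonical-complete C (∃∙ r D) h
... | E , m , t = ≤-<-trans (⊑-depth E D (canonical-sound E D t)) (successor-depth C m)

≣-refl : ∀ C → C ≣ C
≣-refl C = (λ I d x → x) , (λ I d x → x)

≣-trans : ∀ C D E → C ≣ D → D ≣ E → C ≣ E
≣-trans C D E (C⊑D , D⊑C) (D⊑E , E⊑D) = ⊑-trans C D E C⊑D D⊑E , ⊑-trans E D C E⊑D D⊑C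

∃-cong : ∀ r C D → C ≣ D → ∃∙ r C ≣ ∃∙ r D
∃-cong r C D (C⊑D , D⊑C) = ∃-mono r C D C⊑D , ∃-mono r D C D⊑C

⊑-⨅-map : ∀ {A : Set} C (f : A → Concept) xs → (∀ {x} → x ∈ xs → C ⊑ f x) → C ⊑ ⨅ (map f xs)
⊑-⨅-map C f xs h = ⊑-⨅ C (map f xs) (All.map⁺ (All.tabulate h))

⨅-map-⊑ : ∀ {A : Set} (f g : A → Concept) xs → (∀ {x} → x ∈ xs → f x ⊑ g x) →
          ⨅ (map f xs) ⊑ ⨅ (map g xs)
⨅-map-⊑ f g xs h = ⊑-⨅-map (⨅ (map f xs)) g xs λ {x} m →
  ⊑-trans (⨅ (map f xs)) (f x) (g x) (⨅-⊑ (map f xs) (∈-map⁺ f m)) (h m)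

⨅-map-≣ : ∀ {A : Set} (f g : A → Concept) xs → (∀ {x} → x ∈ xs → f x ≣ g x) →
          ⨅ (map f xs) ≣ ⨅ (map g xs)
⨅-map-≣ f g xs h = ⨅-map-⊑ f g xs (proj₁ ∘ h) , ⨅-map-⊑ g f xs (proj₂ ∘ h)

∈-concatMap-transfer : ∀ {A B : Set} (f : A → List B) {y z : B} →
                       (∀ x → y ∈ f x → z ∈ f x) → ∀ xs → y ∈ concatMap f xs → z ∈ concatMap f xs
∈-concatMap-transfer f h xs = ∈-concatMap⁺ f ∘ Any.map (λ {x} → h x) ∘ ∈-concatMap⁻ f {xs = xs}

filler-∈subAtoms : ∀ {r A} a → aex r A ∈ subAtoms a → aname A ∈ subAtoms a
filler-∈subAtoms (aex _ _) (here refl) = there (here refl)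
filler-∈subAtoms (aex _ _) (there (here ()))
filler-∈subAtoms (aex _ _) (there (there ()))
filler-∈subAtoms (aname _) (here ())
filler-∈subAtoms (aname _) (there ())

filler-∈At : ∀ Γ {r A} → aex r A ∈At Γ → aname A ∈At Γ
filler-∈At Γ m with ∈-++⁻ (concatMap (λ s → concatMap subAtoms (lhs s ++ (rhs s ∷ []))) (subs Γ)) m
... | inj₁ m₁ = ∈-++⁺ˡ (∈-concatMap-transfer _
      (λ s → ∈-concatMap-transfer subAtoms filler-∈subAtoms (lhs s ++ (rhs s ∷ []))) (subs Γ) m₁)
... | inj₂ m₂ with satisfied (∈-concatMap⁻ _ {xs = diss Γ} m₂)
...   | _ , here ()
...   | _ , there (here ())
...   | _ , there (there ())

module Unfolding (Γ : Problem) (σ : Subst) (T : Assignment)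
  (T⊆Atnv : ∀ {Y D} → D ∈ T Y → D ∈Atnv Γ)
  (σ⊑T : ∀ {Y D} → D ∈ T Y → σ Y ⊑ substAtom σ D)
  (⨅T⊑σ : ∀ {Y} → Y ∈Nv Γ → ⨅ (map (substAtom σ) (T Y)) ⊑ σ Y)
  where

  filler-depth : ∀ {Y r Z} → aex r (var Z) ∈ T Y → depth (σ Z) < depth (σ Y)
  filler-depth {Y} {r} {Z} m = ⊑-depth (σ Y) (∃∙ r (σ Z)) (σ⊑T m)

  -- approx n Y computes σ_T(Y) correctly once n exceeds the role depth of
  -- σ(Y), since every unfolding step passes to fillers of smaller depth.
  approx : ℕ → Subst
  approx zero    _ = ⊤c
  approx (suc n) Y = ⨅ (map (substAtom (approx n)) (T Y))

  unfold : Subst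
  unfold Y = approx (suc (depth (σ Y))) Y

  substAtom-local : ∀ {g h : Subst} {Y D} → (∀ {Z} → depth (σ Z) < depth (σ Y) → g Z ≡ h Z) →
                    D ∈ T Y → substAtom g D ≡ substAtom h D
  substAtom-local {D = aname (var _)} _ m = ⊥-elim (proj₂ (T⊆Atnv m))
  substAtom-local {D = aname (con _)} _ _ = refl
  substAtom-local {D = aex _ (con _)} _ _ = refl
  substAtom-local {D = aex r (var _)} g≡h m = cong (∃∙ r) (g≡h (filler-depth m))

  approx-stable : ∀ m n {Y} → depth (σ Y) < m → depth (σ Y) < n → approx m Y ≡ approx n Y
  approx-stable (suc m) (suc n) {Y} (s≤s dm) (s≤s dn) =
    cong ⨅ (map-cong-local (All.tabulate (substAtom-local λ lt →
      approx-stable m n (<-≤-trans lt dm) (<-≤-trans lt dn))))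

  unfold-induced : IsInduced Γ T unfold
  unfold-induced {X} _ =
    cong ⨅ (map-cong-local (All.tabulate (substAtom-local λ lt → approx-stable _ _ lt ≤-refl)))

  approx-≣ : ∀ n {Y} → Y ∈Nv Γ → depth (σ Y) < n → approx n Y ≣ σ Y
  approx-≣ (suc n) {Y} Y∈Nv (s≤s dn) =
    ≣-trans (approx (suc n) Y) (⨅ (map (substAtom σ) (T Y))) (σ Y)
      (⨅-map-≣ (substAtom (approx n)) (substAtom σ) (T Y) atom-≣)
      (⨅T⊑σ Y∈Nv , ⊑-⨅-map (σ Y) (substAtom σ) (T Y) σ⊑T)
    where
    atom-≣ : ∀ {D} → D ∈ T Y → substAtom (approx n) D ≣ substAtom σ D
    atom-≣ {aname (var _)} m = ⊥-elim (proj₂ (T⊆Atnv m))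
    atom-≣ {aname (con A)} _ = ≣-refl (cname (con A))
    atom-≣ {aex r (con A)} _ = ≣-refl (∃∙ r (cname (con A)))
    atom-≣ {aex r (var Z)} m =
      ∃-cong r (approx n Z) (σ Z)
        (approx-≣ n (filler-∈At Γ (proj₁ (T⊆Atnv m))) (<-≤-trans (filler-depth m) dn))

  unfold-≣ : ∀ {Y} → Y ∈Nv Γ → unfold Y ≣ σ Y
  unfold-≣ Y∈Nv = approx-≣ _ Y∈Nv ≤-refl

nonVar?-sound : ∀ D → nonVar? D ≡ true → NonVar D
nonVar?-sound (aname (con _)) _ = tt
nonVar?-sound (aex _ _) _ = tt

nonVar?-complete : ∀ D → NonVar D → nonVar? D ≡ true
nonVar?-complete (aname (con _)) _ = refl
nonVar?-complete (aex _ _) _ = refl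

∈-Sτ⁻ : ∀ Γ τ {X D} → D ∈ Sτ Γ τ X → D ∈Atnv Γ × τ [ vX X ⊑ᵖ D ] ≡ true
∈-Sτ⁻ Γ τ {X} {D} m with ∈-filter⁻ (λ D → nonVar? D ≟ᴮ true) m
... | m₁ , nv with ∈-filter⁻ (λ D → τ [ vX X ⊑ᵖ D ] ≟ᴮ true) {xs = At Γ} m₁
...   | m₂ , t = (m₂ , nonVar?-sound D nv) , t

∈-Sτ⁺ : ∀ Γ τ {X D} → D ∈Atnv Γ → τ [ vX X ⊑ᵖ D ] ≡ true → D ∈ Sτ Γ τ X
∈-Sτ⁺ Γ τ {X} {D} (m , nv) t =
  ∈-filter⁺ (λ D → nonVar? D ≟ᴮ true)
    (∈-filter⁺ (λ D → τ [ vX X ⊑ᵖ D ] ≟ᴮ true) m t) (nonVar?-complete D nv)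

from-does : ∀ {a} {A : Set a} (a? : Dec A) → does a? ≡ true → A
from-does (yes a) _ = a
from-does (no _) ()

valuation : Subst → Valuation
valuation σ [ C ⊑ᵖ D ] = does (⊑-dec (substAtom σ C) (substAtom σ D))
valuation σ [ X >ᵖ Y ] = does (depth (σ Y) <? depth (σ X))
valuation σ (p C X D) =
  does (¬? (⊑-dec (substAtom σ C) (substAtom σ D)) ×-dec ⊑-dec (σ X) (substAtom σ D))

nonVar-prime : ∀ σ D → NonVar D → Prime (substAtom σ D)
nonVar-prime σ (aname (con A)) _ = name-prime (con A)
nonVar-prime σ (aex r A) _ = ∃-prime r (substName σ A)

module LocalSolution (Γ : Problem) (σ : Subst) (σ-solves : IsSolution Γ σ) (S : Assignment)
  (S⊆Atnv : ∀ {X} → X ∈Nv Γ → ∀ {D} → D ∈ S X → D ∈Atnv Γ) (σ≡σS : IsInduced Γ S σ)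
  where

  τ : Valuation
  τ = valuation σ

  σ̂ : Atom → Concept
  σ̂ = substAtom σ

  σ⊑S : ∀ {X D} → X ∈Nv Γ → D ∈ S X → σ X ⊑ σ̂ D
  σ⊑S {X} {D} X∈Nv m =
    subst (_⊑ σ̂ D) (sym (σ≡σS X∈Nv)) (⨅-⊑ (map σ̂ (S X)) (∈-map⁺ σ̂ m))

  separating-atom : ∀ C {X} → X ∈Nv Γ → ¬ (C ⊑ σ X) →
                    Σ Atom (λ D → D ∈Atnv Γ × ¬ (C ⊑ σ̂ D) × σ X ⊑ σ̂ D)
  separating-atom C {X} X∈Nv C⋢X
    with find (All.¬All⇒Any¬ (⊑-dec C) (map σ̂ (S X))
                 (C⋢X ∘ subst (C ⊑_) (sym (σ≡σS X∈Nv)) ∘ ⊑-⨅ C (map σ̂ (S X))))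
  ... | _ , mE , C⋢E with ∈-map⁻ σ̂ mE
  ...   | D , mD , refl = D , S⊆Atnv X∈Nv mD , C⋢E , σ⊑S X∈Nv mD

  τ-⊑⁺ : ∀ C D → σ̂ C ⊑ σ̂ D → τ [ C ⊑ᵖ D ] ≡ true
  τ-⊑⁺ C D = dec-true (⊑-dec (σ̂ C) (σ̂ D))

  τ-⊑⁻ : ∀ C D → τ [ C ⊑ᵖ D ] ≡ true → σ̂ C ⊑ σ̂ D
  τ-⊑⁻ C D = from-does (⊑-dec (σ̂ C) (σ̂ D))

  τ-⋢ : ∀ C D → ¬ (σ̂ C ⊑ σ̂ D) → τ [ C ⊑ᵖ D ] ≡ false
  τ-⋢ C D = dec-false (⊑-dec (σ̂ C) (σ̂ D))

  τ->⁺ : ∀ X Y → depth (σ Y) < depth (σ X) → τ [ X >ᵖ Y ] ≡ true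
  τ->⁺ X Y = dec-true (depth (σ Y) <? depth (σ X))

  τ->⁻ : ∀ X Y → τ [ X >ᵖ Y ] ≡ true → depth (σ Y) < depth (σ X)
  τ->⁻ X Y = from-does (depth (σ Y) <? depth (σ X))

  τ-p⁺ : ∀ C X D → ¬ (σ̂ C ⊑ σ̂ D) → σ X ⊑ σ̂ D → τ (p C X D) ≡ true
  τ-p⁺ C X D C⋢D X⊑D = dec-true (¬? (⊑-dec (σ̂ C) (σ̂ D)) ×-dec ⊑-dec (σ X) (σ̂ D)) (C⋢D , X⊑D)

  τ-p⁻ : ∀ C X D → τ (p C X D) ≡ true → ¬ (σ̂ C ⊑ σ̂ D) × σ X ⊑ σ̂ D
  τ-p⁻ C X D = from-does (¬? (⊑-dec (σ̂ C) (σ̂ D)) ×-dec ⊑-dec (σ X) (σ̂ D))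

  lhs-prime : ∀ cs E → NonVar E → ⨅ (map σ̂ cs) ⊑ σ̂ E → Any (λ C → τ [ C ⊑ᵖ E ] ≡ true) cs
  lhs-prime cs E nv h =
    Any.map (λ {C} → τ-⊑⁺ C E) (Any.map⁻ (⨅-prime (σ̂ E) (nonVar-prime σ E nv) (map σ̂ cs) h))

  satisfies : Satisfies Γ τ
  satisfies = record
    { Ia   = λ {s} m nv → lhs-prime (lhs s) (rhs s) nv (proj₁ σ-solves m)
    ; Ib   = λ {cs} {X} m {E} E∈Atnv t → lhs-prime cs E (proj₂ E∈Atnv)
               (⊑-trans (⨅ (map σ̂ cs)) (σ X) (σ̂ E) (proj₁ σ-solves m) (τ-⊑⁻ (vX X) E t))
    ; Ic   = λ {d} m → τ-⋢ (vX (dl d)) (vX (dr d)) (proj₂ σ-solves m)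
    ; IIa  = λ {A} _ → τ-⊑⁺ (aname (con A)) (aname (con A)) (λ I d x → x)
    ; IIb  = λ {A} {B} _ _ A≢B → τ-⋢ (aname (con A)) (aname (con B)) λ h →
               A≢B (con-injective (name-⊑-name⁻ (con A) (con B) h))
    ; IIc  = λ {r} {A} {s} {B} _ _ r≢s → τ-⋢ (aex r A) (aex s B) λ h →
               r≢s (proj₁ (∃-⊑-∃⁻ r s (substName σ A) (substName σ B) h))
    ; IId₁ = λ {A} {r} {B} _ _ → τ-⋢ (aname (con A)) (aex r B) (name-⋢-∃ (con A) r (substName σ B))
    ; IId₂ = λ {A} {r} {B} _ _ → τ-⋢ (aex r B) (aname (con A)) (∃-⋢-name (con A) r (substName σ B))
    ; IIe₁ = λ {r} {A} {B} _ _ t → τ-⊑⁺ (aname A) (aname B)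
               (proj₂ (∃-⊑-∃⁻ r r (substName σ A) (substName σ B) (τ-⊑⁻ (aex r A) (aex r B) t)))
    ; IIe₂ = λ {r} {A} {B} _ _ t → τ-⊑⁺ (aex r A) (aex r B)
               (∃-mono r (substName σ A) (substName σ B) (τ-⊑⁻ (aname A) (aname B) t))
    ; III  = λ {C₁} {C₂} {C₃} _ _ _ t₁ t₂ → τ-⊑⁺ C₁ C₃
               (⊑-trans (σ̂ C₁) (σ̂ C₂) (σ̂ C₃) (τ-⊑⁻ C₁ C₂ t₁) (τ-⊑⁻ C₂ C₃ t₂))
    ; IV₁  = IV₁
    ; IV₂  = λ {C} {X} {D} _ _ _ t → τ-⊑⁺ (vX X) D (proj₂ (τ-p⁻ C X D t))
    ; IV₃  = λ {C} {X} {D} _ _ _ (t , t′) → proj₁ (τ-p⁻ C X D t) (τ-⊑⁻ C D t′)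
    ; Va   = λ {X} _ → dec-false (depth (σ X) <? depth (σ X)) (<-irrefl refl)
    ; Vb   = λ {X} {Y} {Z} _ _ _ t t′ → τ->⁺ X Z (<-trans (τ->⁻ Y Z t′) (τ->⁻ X Y t))
    ; Vc   = λ {X} {Y} {r} _ _ _ t → τ->⁺ X Y
               (⊑-depth (σ X) (∃∙ r (σ Y)) (τ-⊑⁻ (vX X) (aex r (var Y)) t))
    }
    where
    con-injective : ∀ {A B} → con A ≡ con B → A ≡ B
    con-injective refl = refl
    IV₁ : ∀ {C X} → C ∈At Γ → X ∈Nv Γ →
          (τ [ C ⊑ᵖ vX X ] ≡ true) ⊎ Σ Atom (λ D → D ∈Atnv Γ × τ (p C X D) ≡ true)
    IV₁ {C} {X} _ X∈Nv with ⊑-dec (σ̂ C) (σ X)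
    ... | yes C⊑X = inj₁ (τ-⊑⁺ C (vX X) C⊑X)
    ... | no C⋢X with separating-atom (σ̂ C) X∈Nv C⋢X
    ...   | D , D∈Atnv , C⋢D , X⊑D = inj₂ (D , D∈Atnv , τ-p⁺ C X D C⋢D X⊑D)

  S⊆Sτ : ∀ {X D} → X ∈Nv Γ → D ∈ S X → D ∈ Sτ Γ τ X
  S⊆Sτ {X} {D} X∈Nv m = ∈-Sτ⁺ Γ τ (S⊆Atnv X∈Nv m) (τ-⊑⁺ (vX X) D (σ⊑S X∈Nv m))

  σ⊑Sτ : ∀ {X D} → D ∈ Sτ Γ τ X → σ X ⊑ σ̂ D
  σ⊑Sτ {X} {D} m = τ-⊑⁻ (vX X) D (proj₂ (∈-Sτ⁻ Γ τ m))

  ⨅Sτ⊑σ : ∀ {X} → X ∈Nv Γ → ⨅ (map σ̂ (Sτ Γ τ X)) ⊑ σ X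
  ⨅Sτ⊑σ {X} X∈Nv = subst (⨅ (map σ̂ (Sτ Γ τ X)) ⊑_) (sym (σ≡σS X∈Nv))
    (⊑-⨅-map (⨅ (map σ̂ (Sτ Γ τ X))) σ̂ (S X) λ m →
      ⨅-⊑ (map σ̂ (Sτ Γ τ X)) (∈-map⁺ σ̂ (S⊆Sτ X∈Nv m)))

  open Unfolding Γ σ (Sτ Γ τ) (proj₁ ∘ ∈-Sτ⁻ Γ τ) σ⊑Sτ ⨅Sτ⊑σ public

lemma6p8 : (Γ : Problem) (σ : Subst) → IsLocalSolution Γ σ →
    Σ Valuation (λ τ → Satisfies Γ τ ×
      Σ Subst (λ σ' → IsInduced Γ (Sτ Γ τ) σ' ×
        (∀ {X} → X ∈Nv Γ → σ' X ≣ σ X)))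
lemma6p8 Γ σ (σ-solves , S , (S⊆Atnv , _) , σ≡σS) =
  τ , satisfies , unfold , unfold-induced , unfold-≣
  where open LocalSolution Γ σ σ-solves S S⊆Atnv σ≡σS
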